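{- Let $p\ge2$, $n\ge1$, and let $0\le k<p^n$ with base-$p$ digits $k=(a_1a_2\dots a_n)_p=a_1p^{n-1}+\dots+a_n$ (leading zeros allowed). Then $\pi_{p^n}(k)=(b_1b_2\dots b_n)_p$, where $b_1=a_1$ and, for $2\le i\le n$, $b_i=a_i$ if $b_1+\dots+b_{i-1}$ is even and $b_i=p-1-a_i$ if $b_1+\dots+b_{i-1}$ is odd.
   Context: The permutation $\pi_{p^n}$ of $\{0,1,\dots,p^n-1\}$ is defined recursively: $\pi_{p^1}$ is the identity on $\{0,\dots,p-1\}$; for $n\ge2$ and $ap^{n-1}\le k<(a+1)p^{n-1}$ (with $0\le a\le p-1$), $\pi_{p^n}(k)=\pi_{p^{n-1}}(k-ap^{n-1})+ap^{n-1}$ if $a$ is even, and $\pi_{p^n}(k)=\pi_{p^{n-1}}(p^{n-1}-(k-ap^{n-1})-1)+ap^{n-1}$ if $a$ is odd. -}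

module Defs where

open import Data.Nat using (ℕ; zero; suc; _+_; _*_; _∸_; _^_; _<_; NonZero)
open import Data.Unit using (⊤)
open import Data.Product using (_×_)
open import Data.Nat.DivMod using (_/_; _%_)
open import Data.Nat.Properties using (m^n≢0)
open import Data.Bool using (Bool; true; false; if_then_else_)
open import Data.Vec using (Vec; []; _∷_)

isEven : ℕ → Bool
isEven zero = true
isEven (suc zero) = false
isEven (suc (suc n)) = isEven n

-- π p n k  =  π_{p^n}(k), for n ≥ 1 (π p 0 is an irrelevant junk value: identity).
-- For n ≥ 2: a = k / p^(n-1) is the block index, r = k - a p^(n-1).
π : (p : ℕ) .{{_ : NonZero p}} → ℕ → ℕ → ℕ
π p zero k = k
π p (suc zero) k = k
π p (suc (suc m)) k =
  let q = p ^ suc m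
      a = _/_ k q {{m^n≢0 p (suc m)}}
      r = k ∸ a * q
  in if isEven a
     then π p (suc m) r + a * q
     else π p (suc m) (q ∸ r ∸ 1) + a * q

value : (p : ℕ) → {n : ℕ} → Vec ℕ n → ℕ
value p {n} [] = 0
value p {suc n} (a ∷ as) = a * p ^ n + value p as

Digits : (p : ℕ) → {n : ℕ} → Vec ℕ n → Set
Digits p [] = ⊤
Digits p (a ∷ as) = (a < p) × Digits p as

-- the digits b₁ … bₙ of the statement, given the digits a₁ … aₙ;
-- s is the running sum b₁ + … + b_{i-1} (empty sum = 0 so b₁ = a₁)
transformFrom : (p : ℕ) → ℕ → {n : ℕ} → Vec ℕ n → Vec ℕ n
transformFrom p s [] = []
transformFrom p s (a ∷ as) =
  let b = if isEven s then a else p ∸ 1 ∸ a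
  in b ∷ transformFrom p (s + b) as

transform : (p : ℕ) → {n : ℕ} → Vec ℕ n → Vec ℕ n
transform p = transformFrom p 0

{-# OPTIONS --safe #-}

-- Writing k = a·q + r with q = p^(n-1) and r < q, the recursion for π peels off the
-- leading digit a and either keeps the remaining digits (a even) or replaces
-- r by q - 1 - r, which is the number whose digits are the complements p - 1 - aᵢ
-- (a odd). So π_{p^n}(k) has leading digit a and the rest is π_{p^{n-1}} applied to
-- the possibly complemented tail. On the digit side, complementing a tail is the
-- same as running the transformation with an odd parity offset, and only the
-- parity of the running sum matters; induction on n finishes the proof.
module Submission where

open import Defs
open import Data.Nat using (ℕ; suc; zero; _≤_; _<_; _^_; NonZero; _+_; _*_; _∸_; s≤s; s≤s⁻¹; z≤n)
open import Data.Nat.Properties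
open import Data.Nat.DivMod using (_/_; +-distrib-/-∣ˡ; m*n/n≡m; m<n⇒m/n≡0)
open import Data.Nat.Divisibility using (n∣m*n)
open import Data.Nat.Solver using (module +-*-Solver)
open import Data.Vec using (Vec; []; _∷_; map)
open import Data.Bool using (true; false; not; if_then_else_)
open import Data.Product using (_,_)
open import Data.Unit using (tt)
open import Relation.Binary.PropositionalEquality
open ≡-Reasoning

isEven-suc : ∀ n → isEven (suc n) ≡ not (isEven n)
isEven-suc zero = refl
isEven-suc (suc zero) = refl
isEven-suc (suc (suc n)) = isEven-suc n

isEven-+-cong : ∀ b s t → isEven s ≡ isEven t → isEven (s + b) ≡ isEven (t + b)
isEven-+-cong zero s t e rewrite +-identityʳ s | +-identityʳ t = e
isEven-+-cong (suc b) s t e rewrite +-suc s b | +-suc t b =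
  trans (isEven-suc (s + b)) (trans (cong not (isEven-+-cong b s t e)) (sym (isEven-suc (t + b))))

[a*q+r]/q≡a : ∀ a {q r} .{{_ : NonZero q}} → r < q → (a * q + r) / q ≡ a
[a*q+r]/q≡a a {q} {r} r<q = begin
  (a * q + r) / q      ≡⟨ +-distrib-/-∣ˡ r (n∣m*n a) ⟩
  a * q / q + r / q    ≡⟨ cong₂ _+_ (m*n/n≡m a q) (m<n⇒m/n≡0 r<q) ⟩
  a + 0                ≡⟨ +-identityʳ a ⟩
  a                    ∎

-- Base p = suc d, so that p ∸ 1 ∸ a reduces to d ∸ a.
module Base (d : ℕ) where

  p : ℕ
  p = suc d

  complement : ∀ {n} → Vec ℕ n → Vec ℕ n
  complement = map (d ∸_)

  complement-digits : ∀ {n} (as : Vec ℕ n) → Digits p as → Digits p (complement as)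
  complement-digits []       _        = tt
  complement-digits (a ∷ as) (_ , ds) = s≤s (m∸n≤m d a) , complement-digits as ds

  value-complement : ∀ {n} (as : Vec ℕ n) → Digits p as →
                     value p (complement as) + (value p as + 1) ≡ p ^ n
  value-complement []                 _          = refl
  value-complement {suc n} (a ∷ as) (a<p , ds) = begin
    ((d ∸ a) * P + vc) + ((a * P + v) + 1)  ≡⟨ regroup (d ∸ a) a P vc v ⟩
    (d ∸ a + a) * P + (vc + (v + 1))        ≡⟨ cong₂ (λ x y → x * P + y) (m∸n+n≡m (s≤s⁻¹ a<p))
                                                                         (value-complement as ds) ⟩
    d * P + P                               ≡⟨ +-comm (d * P) P ⟩
    p * P                                   ∎
    where
    P  = p ^ n
    v  = value p as
    vc = value p (complement as)
    open +-*-Solver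
    regroup : ∀ c a P vc v → (c * P + vc) + ((a * P + v) + 1) ≡ (c + a) * P + (vc + (v + 1))
    regroup = solve 5 (λ c a P vc v → (c :* P :+ vc) :+ ((a :* P :+ v) :+ con 1)
                                    := (c :+ a) :* P :+ (vc :+ (v :+ con 1))) refl

  value<p^n : ∀ {n} (as : Vec ℕ n) → Digits p as → value p as < p ^ n
  value<p^n as ds = subst (value p as <_) (value-complement as ds)
    (<-≤-trans (m<m+n (value p as) (s≤s z≤n))
               (m≤n+m (value p as + 1) (value p (complement as))))

  value-complement-∸ : ∀ {n} (as : Vec ℕ n) → Digits p as →
                       p ^ n ∸ value p as ∸ 1 ≡ value p (complement as)
  value-complement-∸ {n} as ds = begin
    p ^ n ∸ v ∸ 1          ≡⟨ ∸-+-assoc (p ^ n) v 1 ⟩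
    p ^ n ∸ (v + 1)        ≡⟨ cong (_∸ (v + 1)) (value-complement as ds) ⟨
    vc + (v + 1) ∸ (v + 1) ≡⟨ m+n∸n≡m vc (v + 1) ⟩
    vc                     ∎
    where
    v  = value p as
    vc = value p (complement as)

  transformFrom-cong-isEven : ∀ {n} s t (as : Vec ℕ n) → isEven s ≡ isEven t →
                              transformFrom p s as ≡ transformFrom p t as
  transformFrom-cong-isEven s t []       e = refl
  transformFrom-cong-isEven s t (a ∷ as) e rewrite e =
    cong (_ ∷_) (transformFrom-cong-isEven _ _ as (isEven-+-cong _ s t e))

  transformFrom-complement : ∀ {n} s (as : Vec ℕ n) → Digits p as →
                             transformFrom p s (complement as) ≡ transformFrom p (suc s) as
  transformFrom-complement s []       _ = refl
  transformFrom-complement s (a ∷ as) (a<p , ds) rewrite isEven-suc s with isEven s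
  ... | true  = cong (d ∸ a ∷_) (transformFrom-complement (s + (d ∸ a)) as ds)
  ... | false rewrite m∸[m∸n]≡n (s≤s⁻¹ a<p) =
    cong (a ∷_) (transformFrom-complement (s + a) as ds)

  π-block : ∀ m a r → r < p ^ suc m →
            π p (suc (suc m)) (a * p ^ suc m + r) ≡
              (if isEven a then π p (suc m) r + a * p ^ suc m
               else π p (suc m) (p ^ suc m ∸ r ∸ 1) + a * p ^ suc m)
  π-block m a r r<q
    rewrite [a*q+r]/q≡a a {{m^n≢0 p (suc m)}} r<q | m+n∸m≡n (a * p ^ suc m) r = refl

  π-block-even : ∀ m a r → r < p ^ suc m → isEven a ≡ true →
                 π p (suc (suc m)) (a * p ^ suc m + r) ≡ π p (suc m) r + a * p ^ suc m
  π-block-even m a r r<q even rewrite π-block m a r r<q | even = refl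

  π-block-odd : ∀ m a r → r < p ^ suc m → isEven a ≡ false →
                π p (suc (suc m)) (a * p ^ suc m + r) ≡
                  π p (suc m) (p ^ suc m ∸ r ∸ 1) + a * p ^ suc m
  π-block-odd m a r r<q odd rewrite π-block m a r r<q | odd = refl

  π-value : ∀ m (as : Vec ℕ (suc m)) → Digits p as →
            π p (suc m) (value p as) ≡ value p (transform p as)
  π-value zero    (a ∷ []) _          = refl
  π-value (suc m) (a ∷ as) (a<p , ds) = trans (by-parity (isEven a) refl) (+-comm _ (a * q))
    where
    q = p ^ suc m
    v = value p as
    v<q = value<p^n as ds

    by-parity : ∀ b → isEven a ≡ b →
                π p (suc (suc m)) (a * q + v) ≡ value p (transformFrom p a as) + a * q
    by-parity true even = begin
      π p (suc (suc m)) (a * q + v)               ≡⟨ π-block-even m a v v<q even ⟩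
      π p (suc m) v + a * q                       ≡⟨ cong (_+ a * q) (π-value m as ds) ⟩
      value p (transformFrom p 0 as) + a * q      ≡⟨ cong (λ t → value p t + a * q)
                                                       (transformFrom-cong-isEven 0 a as (sym even)) ⟩
      value p (transformFrom p a as) + a * q      ∎
    by-parity false odd = begin
      π p (suc (suc m)) (a * q + v)               ≡⟨ π-block-odd m a v v<q odd ⟩
      π p (suc m) (q ∸ v ∸ 1) + a * q             ≡⟨ cong (λ k → π p (suc m) k + a * q)
                                                       (value-complement-∸ as ds) ⟩
      π p (suc m) (value p cas) + a * q           ≡⟨ cong (_+ a * q)
                                                       (π-value m cas (complement-digits as ds)) ⟩
      value p (transformFrom p 0 cas) + a * q     ≡⟨ cong (λ t → value p t + a * q)
                                                       (transformFrom-complement 0 as ds) ⟩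
      value p (transformFrom p 1 as) + a * q      ≡⟨ cong (λ t → value p t + a * q)
                                                       (transformFrom-cong-isEven 1 a as (sym odd)) ⟩
      value p (transformFrom p a as) + a * q      ∎
      where cas = complement as

proposition4 : (p : ℕ) .{{_ : NonZero p}} → 2 ≤ p → (n : ℕ) → 1 ≤ n →
    (as : Vec ℕ n) → Digits p as →
    π p n (value p as) ≡ value p (transform p as)
proposition4 (suc d) _ (suc m) _ = Base.π-value d m
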